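{- Let $G$ be a graph and let $c_1$ be a $k$-coloring of $G$ having a color class with at most one vertex. Then for every $k$-coloring $c$ of $G$ there exist a $k$-coloring $c_2$ of $G$ and colors $i,j$ with $c_2^{ -1}(i)=c^{ -1}(j)=:C$, such that $c_2$ can be obtained from $c_1$ by a sequence of single-vertex recolorings, each intermediate coloring being a proper $k$-coloring, in which every vertex of $C$ is recolored at most once and no other vertex is recolored.
   Context: A $k$-coloring is a proper coloring with colors from $\{1,\dots,k\}$; for a coloring $c$ and color $i$, $c^{ -1}(i)$ is the color class of $i$ (possibly empty). -}

module Defs where

open import Data.Nat using (ℕ)
open import Data.Fin using (Fin; _≟_)
open import Data.List using (List; []; _∷_)
open import Data.List.Relation.Unary.All using (All)
open import Data.List.Relation.Unary.Unique.Propositional using (Unique)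
open import Data.Product using (Σ; _×_; ∃; ∃-syntax)
open import Relation.Binary.PropositionalEquality using (_≡_; _≢_)
open import Relation.Nullary using (¬_; yes; no)
open import Function.Bundles using (_⇔_)
open import Level using (0ℓ)

record Graph (n : ℕ) : Set₁ where
  field
    Adj     : Fin n → Fin n → Set
    sym     : ∀ {u v} → Adj u v → Adj v u
    irrefl  : ∀ {v} → ¬ Adj v v
open Graph public

Colouring : ℕ → ℕ → Set
Colouring n k = Fin n → Fin k

Proper : ∀ {n k} → Graph n → Colouring n k → Set
Proper G c = ∀ u v → Adj G u v → c u ≢ c v

ClassAtMostOne : ∀ {n k} → Colouring n k → Fin k → Set
ClassAtMostOne c i = ∀ u v → c u ≡ i → c v ≡ i → u ≡ v

SameClass : ∀ {n k} → Colouring n k → Fin k → Colouring n k → Fin k → Set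
SameClass c₂ i c j = ∀ v → (c₂ v ≡ i) ⇔ (c v ≡ j)

recolour : ∀ {n k} → Colouring n k → Fin n → Fin k → Colouring n k
recolour c v a u with u ≟ v
... | yes _ = a
... | no  _ = c u

-- Recolouring sequence from c to c' in which the list of recoloured vertices
-- (in order, with repetitions) is vs; every intermediate colouring is proper.
data Reconf {n k} (G : Graph n) : Colouring n k → Colouring n k → List (Fin n) → Set where
  done : ∀ {c} → Reconf G c c []
  step : ∀ {c c' vs} (v : Fin n) (a : Fin k) →
         Proper G (recolour c v a) →
         Reconf G (recolour c v a) c' vs →
         Reconf G c c' (v ∷ vs)

{-# OPTIONS --safe #-}
module Submission where

open import Defs
open import Data.Nat using (ℕ)
open import Data.Fin using (Fin; _≟_)
open import Data.Fin.Properties using (any?)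
open import Data.List using (List; []; _∷_; filter; allFin)
open import Data.List.Relation.Unary.All using (All; []; _∷_)
open import Data.List.Relation.Unary.All.Properties using (all-filter)
open import Data.List.Relation.Unary.Any using (here; there)
open import Data.List.Membership.Propositional using (_∈_)
open import Data.List.Membership.Propositional.Properties using (∈-filter⁺; ∈-allFin)
open import Data.List.Relation.Unary.Unique.Propositional using (Unique)
open import Data.List.Relation.Unary.Unique.Propositional.Properties using (allFin⁺; filter⁺)
open import Data.Product using (_×_; ∃-syntax; _,_)
open import Data.Sum using (_⊎_; inj₁; inj₂)
open import Data.Empty using (⊥-elim)
open import Function.Bundles using (mk⇔)
open import Level using (0ℓ)
open import Relation.Binary.PropositionalEquality using (_≡_; refl; trans; cong) renaming (sym to ≡-sym)
open import Relation.Nullary using (¬_; yes; no)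
open import Relation.Unary using (Pred; _⊆_)

-- The class of i₁ in c₁ is contained in a single class C = c⁻¹(j)
-- of c. Recolour the vertices of C to i₁ one at a time. Throughout, every
-- vertex of colour i₁ lies in C, and C is independent since c is proper, so a
-- vertex newly coloured i₁ never has a neighbour of colour i₁. At the end the
-- class of i₁ is exactly C.

module _ {n k : ℕ} where

  recolour-self : (d : Colouring n k) (v : Fin n) (a : Fin k) → recolour d v a v ≡ a
  recolour-self d v a with v ≟ v
  ... | yes _  = refl
  ... | no v≢v = ⊥-elim (v≢v refl)

  recolour-cases : (d : Colouring n k) (v : Fin n) (a : Fin k) (u : Fin n) →
                   (u ≡ v × recolour d v a u ≡ a) ⊎ recolour d v a u ≡ d u
  recolour-cases d v a u with u ≟ v
  ... | yes u≡v = inj₁ (u≡v , refl)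
  ... | no  _   = inj₂ refl

  recolour-keeps : (d : Colouring n k) (v : Fin n) (a : Fin k) (u : Fin n) →
                   d u ≡ a → recolour d v a u ≡ a
  recolour-keeps d v a u du≡a with recolour-cases d v a u
  ... | inj₁ (_ , eq) = eq
  ... | inj₂ eq       = trans eq du≡a

  recolourAll : Colouring n k → Fin k → List (Fin n) → Colouring n k
  recolourAll d a []       = d
  recolourAll d a (v ∷ vs) = recolourAll (recolour d v a) a vs

  recolourAll-keeps : (d : Colouring n k) (a : Fin k) (vs : List (Fin n)) (u : Fin n) →
                      d u ≡ a → recolourAll d a vs u ≡ a
  recolourAll-keeps d a []       u du≡a = du≡a
  recolourAll-keeps d a (v ∷ vs) u du≡a =
    recolourAll-keeps (recolour d v a) a vs u (recolour-keeps d v a u du≡a)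

  recolourAll-∈ : (d : Colouring n k) (a : Fin k) (vs : List (Fin n)) (u : Fin n) →
                  u ∈ vs → recolourAll d a vs u ≡ a
  recolourAll-∈ d a (u ∷ vs) u (here refl) =
    recolourAll-keeps (recolour d u a) a vs u (recolour-self d u a)
  recolourAll-∈ d a (v ∷ vs) u (there u∈vs) = recolourAll-∈ (recolour d v a) a vs u u∈vs

  colourClass : Colouring n k → Fin k → Pred (Fin n) 0ℓ
  colourClass d a u = d u ≡ a

  Independent : Graph n → Pred (Fin n) 0ℓ → Set
  Independent G S = ∀ u v → Adj G u v → S u → ¬ S v

  Proper⇒colourClass-independent : (G : Graph n) (c : Colouring n k) → Proper G c →
                                   (a : Fin k) → Independent G (colourClass c a)
  Proper⇒colourClass-independent G c c-proper a u v uv cu≡a cv≡a =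
    c-proper u v uv (trans cu≡a (≡-sym cv≡a))

  colourClass-⊆-recolour : (d : Colouring n k) (a : Fin k) {S : Pred (Fin n) 0ℓ} {v : Fin n} →
                           colourClass d a ⊆ S → S v → colourClass (recolour d v a) a ⊆ S
  colourClass-⊆-recolour d a {v = v} class⊆S Sv {u} eq with recolour-cases d v a u
  ... | inj₁ (refl , _) = Sv
  ... | inj₂ eq′        = class⊆S (trans (≡-sym eq′) eq)

  colourClass-⊆-recolourAll : (d : Colouring n k) (a : Fin k) {S : Pred (Fin n) 0ℓ}
                              (vs : List (Fin n)) → colourClass d a ⊆ S → All S vs →
                              colourClass (recolourAll d a vs) a ⊆ S
  colourClass-⊆-recolourAll d a []       class⊆S []          = class⊆S
  colourClass-⊆-recolourAll d a (v ∷ vs) class⊆S (Sv ∷ Svs) =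
    colourClass-⊆-recolourAll (recolour d v a) a vs (colourClass-⊆-recolour d a class⊆S Sv) Svs

  -- A vertex recoloured to a lies in S, as does every vertex already coloured a;
  -- independence of S forbids an edge between them.
  Proper-recolour : (G : Graph n) {S : Pred (Fin n) 0ℓ} → Independent G S →
                    (d : Colouring n k) (a : Fin k) {v : Fin n} →
                    Proper G d → colourClass d a ⊆ S → S v → Proper G (recolour d v a)
  Proper-recolour G S-indep d a {v} d-proper class⊆S Sv u w uw eq
    with recolour-cases d v a u | recolour-cases d v a w
  ... | inj₁ (refl , _)   | inj₁ (refl , _)   = irrefl G uw
  ... | inj₁ (refl , du′) | inj₂ dw′ =
    S-indep u w uw Sv (class⊆S (trans (≡-sym dw′) (trans (≡-sym eq) du′)))
  ... | inj₂ du′ | inj₁ (refl , dw′) =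
    S-indep u w uw (class⊆S (trans (≡-sym du′) (trans eq dw′))) Sv
  ... | inj₂ du′ | inj₂ dw′ = d-proper u w uw (trans (≡-sym du′) (trans eq dw′))

  recolourAll-Reconf : (G : Graph n) {S : Pred (Fin n) 0ℓ} → Independent G S →
                       (d : Colouring n k) (a : Fin k) (vs : List (Fin n)) →
                       Proper G d → colourClass d a ⊆ S → All S vs →
                       Reconf G d (recolourAll d a vs) vs
  recolourAll-Reconf G S-indep d a []       d-proper class⊆S []          = done
  recolourAll-Reconf G S-indep d a (v ∷ vs) d-proper class⊆S (Sv ∷ Svs) =
    step v a d′-proper
      (recolourAll-Reconf G S-indep (recolour d v a) a vs d′-proper
        (colourClass-⊆-recolour d a class⊆S Sv) Svs)
    where
    d′-proper : Proper G (recolour d v a)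
    d′-proper = Proper-recolour G S-indep d a d-proper class⊆S Sv

  Reconf-Proper : (G : Graph n) {c c′ : Colouring n k} {vs : List (Fin n)} →
                  Proper G c → Reconf G c c′ vs → Proper G c′
  Reconf-Proper G c-proper done                     = c-proper
  Reconf-Proper G c-proper (step v a c″-proper seq) = Reconf-Proper G c″-proper seq

  -- If the class is empty any colour works; we take i itself.
  ClassAtMostOne⇒⊆colourClass : (c₁ c : Colouring n k) (i : Fin k) → ClassAtMostOne c₁ i →
                                ∃[ j ] colourClass c₁ i ⊆ colourClass c j
  ClassAtMostOne⇒⊆colourClass c₁ c i atMostOne with any? (λ w → c₁ w ≟ i)
  ... | yes (w , c₁w≡i) = c w , λ {u} c₁u≡i → cong c (atMostOne u w c₁u≡i c₁w≡i)
  ... | no  empty       = i , λ {u} c₁u≡i → ⊥-elim (empty (u , c₁u≡i))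

lemma9 : ∀ {n k} (G : Graph n) (c₁ : Colouring n k) → Proper G c₁ →
    ∃[ i₁ ] ClassAtMostOne c₁ i₁ →
    (c : Colouring n k) → Proper G c →
    ∃[ c₂ ] ∃[ i ] ∃[ j ] ∃[ vs ]
      (Proper G c₂ × SameClass c₂ i c j ×
       Reconf G c₁ c₂ vs × All (λ v → c v ≡ j) vs × Unique vs)
lemma9 {n} {k} G c₁ c₁-proper (i , atMostOne) c c-proper
  with ClassAtMostOne⇒⊆colourClass c₁ c i atMostOne
... | j , class⊆C =
  c₂ , i , j , C , Reconf-Proper G c₁-proper reconf , sameClass , reconf , C⊆class , C-unique
  where
  C : List (Fin n)
  C = filter (λ v → c v ≟ j) (allFin n)

  C⊆class : All (colourClass c j) C
  C⊆class = all-filter (λ v → c v ≟ j) (allFin n)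

  C-unique : Unique C
  C-unique = filter⁺ (λ v → c v ≟ j) (allFin⁺ n)

  c₂ : Colouring n k
  c₂ = recolourAll c₁ i C

  reconf : Reconf G c₁ c₂ C
  reconf = recolourAll-Reconf G (Proper⇒colourClass-independent G c c-proper j)
             c₁ i C c₁-proper class⊆C C⊆class

  sameClass : SameClass c₂ i c j
  sameClass v = mk⇔ (colourClass-⊆-recolourAll c₁ i C class⊆C C⊆class)
                    (λ cv≡j → recolourAll-∈ c₁ i C v (∈-filter⁺ (λ v → c v ≟ j) (∈-allFin v) cv≡j))
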